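{- For $k \geq 2$, let $ex_{out}(n;k)$ denote the largest size (number of arcs) of an out-regular $k$-geodetic digraph with order $n$. Then $ex_{out}(n;k) \sim n^{\frac{k+1}{k}}$ as $n \rightarrow \infty$.
   Context: A digraph has a vertex set and an arc set consisting of ordered pairs of distinct vertices (no loops, no multiple arcs). A walk of length $\ell$ is a sequence $x_0x_1\dots x_\ell$ of vertices with $x_i \rightarrow x_{i+1}$ for all $i$. A digraph is $k$-geodetic if for every ordered pair $(u,v)$ of (not necessarily distinct) vertices there is at most one $u,v$-walk of length at most $k$ (the trivial walk of length $0$ counts when $u=v$). A digraph is out-regular if all vertices have the same out-degree. The size of a digraph is its number of arcs and its order is its number of vertices. -}

module Defs where

open import Data.Nat using (ℕ; zero; suc; _+_; _*_; _≤_)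
open import Data.Bool using (Bool; true; false)
open import Data.Fin using (Fin)
open import Data.List using (List; map; allFin; length; filter)
open import Data.Nat.ListAction using (sum)
open import Data.Product using (Σ; ∃; _×_; _,_)
open import Relation.Binary.PropositionalEquality using (_≡_)
open import Data.Bool.Properties using (T?)
open import Data.Bool using (T)

record Digraph (n : ℕ) : Set where
  field
    arc   : Fin n → Fin n → Bool
    loopless : ∀ i → arc i i ≡ false
open Digraph public

outdeg : ∀ {n} → Digraph n → Fin n → ℕ
outdeg {n} D i = length (filter (λ j → T? (arc D i j)) (allFin n))

size : ∀ {n} → Digraph n → ℕ
size {n} D = sum (map (outdeg D) (allFin n))

OutRegular : ∀ {n} → Digraph n → Set
OutRegular {n} D = ∃ λ d → ∀ (i : Fin n) → outdeg D i ≡ d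

data Walk {n} (D : Digraph n) : Fin n → Fin n → ℕ → Set where
  nil  : ∀ {u} → Walk D u u 0
  cons : ∀ {u w v ℓ} → arc D u w ≡ true → Walk D w v ℓ → Walk D u v (suc ℓ)

-- k-geodetic: for all u v (not necessarily distinct) at most one u,v-walk
-- of length at most k.
Geodetic : ∀ {n} → ℕ → Digraph n → Set
Geodetic {n} k D =
  ∀ (u v : Fin n) (ℓ₁ ℓ₂ : ℕ) (p : Walk D u v ℓ₁) (q : Walk D u v ℓ₂) →
    ℓ₁ ≤ k → ℓ₂ ≤ k →
    _≡_ {A = Σ ℕ (Walk D u v)} (ℓ₁ , p) (ℓ₂ , q)

IsExOut : ℕ → ℕ → ℕ → Set
IsExOut n k e =
  (Σ (Digraph n) λ D → OutRegular D × Geodetic k D × size D ≡ e) ×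
  (∀ (D : Digraph n) → OutRegular D → Geodetic k D → size D ≤ e)

-- Upper bound: in an out-regular k-geodetic digraph of out-degree c, the c ^ k walks of length k
-- from a vertex end at distinct vertices (the Moore bound), so its size e = n c satisfies
-- e ^ k ≤ n ^ (k + 1).
-- Lower bound: choose B with B ^ k ≤ n < (B + 1) ^ k. Take the words of length k over B letters as
-- vertices and let a word s point to each word obtained by deleting the first letter of s and
-- appending one of B ∸ k fixed letters absent from s; further vertices copy the out-arcs of one word.
-- This digraph is out-regular and k-geodetic with n (B ∸ k) arcs, and B ∸ k ~ n ^ (1 / k).

module Submission where

open import Defs
open import Data.Nat using (ℕ; zero; suc; _+_; _*_; _∸_; _^_; _≤_; _<_; z≤n; s≤s; _<?_; NonZero; >-nonZero⁻¹)
open import Data.Nat.Properties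
open import Data.Nat.Tactic.RingSolver using (solve-∀)
open import Data.Bool using (Bool; true; false)
open import Data.Bool.Properties using (T?; T-≡)
open import Data.Fin as Fin using (Fin; zero; suc; combine; remQuot; splitAt; _↑ˡ_; cast)
open import Data.Fin.Properties
  using (combine-remQuot; remQuot-combine; splitAt-↑ˡ; splitAt⁻¹-↑ˡ; ↑ˡ-injective; injective⇒≤; cast-involutive)
open import Data.List using (List; []; _∷_; _++_; _∷ʳ_; map; length; filter; drop; take; lookup; replicate; allFin)
open import Data.List.Properties
  using (∷-injectiveˡ; ∷-injectiveʳ; ++-cancelˡ; ++-assoc; ++-identityʳ; length-++; length-drop;
         length-map; length-take; length-tabulate; length-replicate; ≡-dec)
open import Data.Nat.ListAction using (sum)
open import Data.List.Relation.Unary.All as All using ()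
open import Data.List.Relation.Unary.Any using (here; there)
open import Data.List.Relation.Unary.Unique.Propositional using (Unique; []; _∷_)
import Data.List.Relation.Unary.Unique.Propositional.Properties as Unique
open import Data.List.Membership.Propositional using (_∈_; _∉_)
open import Data.List.Membership.Propositional.Properties
  using (∈-map⁺; ∈-map⁻; ∈-filter⁺; ∈-filter⁻; ∈-allFin; ∈-lookup; ∈-++⁺ˡ; ∈-++⁺ʳ)
import Data.List.Membership.DecPropositional as DecMembership
import Data.List.Relation.Binary.Sublist.Propositional as Sublist
open import Data.List.Relation.Binary.Sublist.Propositional.Properties using (take-⊆; drop-⊆)
open import Data.Product using (Σ; ∃; ∃₂; _×_; _,_; proj₁; proj₂)
open import Data.Sum using (_⊎_; inj₁; inj₂)
open import Data.Empty using (⊥; ⊥-elim)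
open import Function.Bundles using (Equivalence)
open import Relation.Nullary using (yes; no; does)
open import Relation.Nullary.Decidable using (dec-true; dec-false)
open import Relation.Binary.PropositionalEquality
open import Relation.Binary.Definitions using (tri<; tri≈; tri>)
open import Axiom.UniquenessOfIdentityProofs.WithK using (uip)

private
  variable
    A : Set

unique⊆⇒length≤ : {xs ys : List A} → Unique xs → (∀ {x} → x ∈ xs → x ∈ ys) → length xs ≤ length ys
unique⊆⇒length≤ {xs = []} _ _ = z≤n
unique⊆⇒length≤ {xs = x ∷ xs} {ys} (x∉xs ∷ u) xs⊆ys =
  subst (suc (length xs) ≤_) (length-remove ys x∈ys) (s≤s (unique⊆⇒length≤ u xs⊆ys∖x))
  where
  remove : ∀ {x} (ys : List A) → x ∈ ys → List A
  remove (_ ∷ ys) (here _)  = ys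
  remove (y ∷ ys) (there p) = y ∷ remove ys p

  length-remove : ∀ {x} (ys : List A) (p : x ∈ ys) → suc (length (remove ys p)) ≡ length ys
  length-remove (_ ∷ ys) (here _)  = refl
  length-remove (y ∷ ys) (there p) = cong suc (length-remove ys p)

  ∈-remove : ∀ {x y} (ys : List A) (p : x ∈ ys) → y ∈ ys → y ≢ x → y ∈ remove ys p
  ∈-remove (_ ∷ ys) (here refl) (here refl) y≢x = ⊥-elim (y≢x refl)
  ∈-remove (_ ∷ ys) (here refl) (there q)   _   = q
  ∈-remove (_ ∷ ys) (there p)   (here y≡z)  _   = here y≡z
  ∈-remove (_ ∷ ys) (there p)   (there q)   y≢x = there (∈-remove ys p q y≢x)

  x∈ys = xs⊆ys (here refl)

  xs⊆ys∖x : ∀ {z} → z ∈ xs → z ∈ remove ys x∈ys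
  xs⊆ys∖x z∈xs = ∈-remove ys x∈ys (xs⊆ys (there z∈xs)) λ z≡x → All.lookup x∉xs z∈xs (sym z≡x)

unique-lookup-injective : {xs : List A} → Unique xs → ∀ {i j} → lookup xs i ≡ lookup xs j → i ≡ j
unique-lookup-injective {xs = x ∷ xs} _ {zero} {zero} _ = refl
unique-lookup-injective {xs = x ∷ xs} (x∉xs ∷ _) {zero} {suc j} eq = ⊥-elim (All.lookup x∉xs (∈-lookup j) eq)
unique-lookup-injective {xs = x ∷ xs} (x∉xs ∷ _) {suc i} {zero} eq = ⊥-elim (All.lookup x∉xs (∈-lookup i) (sym eq))
unique-lookup-injective {xs = x ∷ xs} (_ ∷ u) {suc i} {suc j} eq = cong suc (unique-lookup-injective u eq)

∈-prefix : ∀ {x : A} as {bs} cs {ds} → as ++ bs ≡ cs ++ x ∷ ds → length cs < length as → x ∈ as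
∈-prefix (a ∷ as) []       eq _         = here (sym (∷-injectiveˡ eq))
∈-prefix (a ∷ as) (c ∷ cs) eq (s≤s lt) = there (∈-prefix as cs (∷-injectiveʳ eq) lt)

length-allFin : ∀ n → length (allFin n) ≡ n
length-allFin n = length-tabulate (λ i → i)

module _ {n : ℕ} where
  open DecMembership (Fin._≟_ {n}) using (_∈?_; _∉?_)

  length-filter-∉ : (s : List (Fin n)) → n ∸ length s ≤ length (filter (_∉? s) (allFin n))
  length-filter-∉ s = m≤n+o⇒m∸n≤o n (length s) (begin
    n                                              ≡⟨ length-allFin n ⟨
    length (allFin n)                              ≤⟨ unique⊆⇒length≤ (Unique.allFin⁺ n) split ⟩
    length (s ++ filter (_∉? s) (allFin n))        ≡⟨ length-++ s ⟩
    length s + length (filter (_∉? s) (allFin n))  ∎)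
    where
    open ≤-Reasoning
    split : ∀ {x} → x ∈ allFin n → x ∈ s ++ filter (_∉? s) (allFin n)
    split {x} x∈ with x ∈? s
    ... | yes x∈s = ∈-++⁺ˡ x∈s
    ... | no x∉s  = ∈-++⁺ʳ s (∈-filter⁺ (_∉? s) x∈ x∉s)

sum-map-const : ∀ (f : A → ℕ) {c} xs → (∀ x → f x ≡ c) → sum (map f xs) ≡ length xs * c
sum-map-const f []       _   = refl
sum-map-const f (x ∷ xs) f≡c = cong₂ _+_ (f≡c x) (sum-map-const f xs f≡c)

module Words {B : ℕ} where

  toWord : ∀ k → Fin (B ^ k) → List (Fin B)
  toWord zero    _ = []
  toWord (suc k) i = proj₁ (remQuot {B} (B ^ k) i) ∷ toWord k (proj₂ (remQuot {B} (B ^ k) i))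

  fromWord : ∀ k → Fin B → List (Fin B) → Fin (B ^ k)
  fromWord zero    _ _       = zero
  fromWord (suc k) z []      = combine z (fromWord k z [])
  fromWord (suc k) z (a ∷ w) = combine a (fromWord k z w)

  length-toWord : ∀ k i → length (toWord k i) ≡ k
  length-toWord zero    _ = refl
  length-toWord (suc k) _ = cong suc (length-toWord k _)

  fromWord-toWord : ∀ k z i → fromWord k z (toWord k i) ≡ i
  fromWord-toWord zero    _ zero = refl
  fromWord-toWord (suc k) z i =
    trans (cong (combine {B} _) (fromWord-toWord k z _)) (combine-remQuot {B} (B ^ k) i)

  toWord-fromWord : ∀ k z w → length w ≡ k → toWord k (fromWord k z w) ≡ w
  toWord-fromWord zero    _ []      _   = refl
  toWord-fromWord (suc k) z (a ∷ w) len =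
    trans (cong (λ (a , i) → a ∷ toWord k i) (remQuot-combine {B} {B ^ k} a _))
          (cong (a ∷_) (toWord-fromWord k z w (suc-injective len)))

  toWord-injective : ∀ k {i j} → toWord k i ≡ toWord k j → i ≡ j
  toWord-injective zero    {zero} {zero} _ = refl
  toWord-injective (suc k) {i}    {j}    eq = begin
    i                                   ≡⟨ combine-remQuot {B} (B ^ k) i ⟨
    combine (proj₁ qi) (proj₂ qi)       ≡⟨ cong₂ combine (∷-injectiveˡ eq) (toWord-injective k (∷-injectiveʳ eq)) ⟩
    combine (proj₁ qj) (proj₂ qj)       ≡⟨ combine-remQuot {B} (B ^ k) j ⟩
    j                                   ∎
    where
    open ≡-Reasoning
    qi = remQuot {B} (B ^ k) i
    qj = remQuot {B} (B ^ k) j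

open Words

successors : ∀ {n} → Digraph n → Fin n → List (Fin n)
successors {n} D u = filter (λ v → T? (arc D u v)) (allFin n)

module _ {n} (D : Digraph n) where

  successors-unique : ∀ u → Unique (successors D u)
  successors-unique u = Unique.filter⁺ _ (Unique.allFin⁺ n)

  ∈-successors⁺ : ∀ {u v} → arc D u v ≡ true → v ∈ successors D u
  ∈-successors⁺ e = ∈-filter⁺ _ (∈-allFin _) (Equivalence.from T-≡ e)

  ∈-successors⁻ : ∀ {u v} → v ∈ successors D u → arc D u v ≡ true
  ∈-successors⁻ v∈ = Equivalence.to T-≡ (proj₂ (∈-filter⁻ _ {xs = allFin n} v∈))

  size-outRegular : ∀ {c} → (∀ u → outdeg D u ≡ c) → size D ≡ n * c
  size-outRegular outdeg≡c = trans (sum-map-const (outdeg D) (allFin n) outdeg≡c) (cong (_* _) (length-allFin n))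

  trail : ∀ {u v ℓ} → Walk D u v ℓ → List (Fin n)
  trail nil                = []
  trail (cons {w = w} _ p) = w ∷ trail p

  geodetic-trail : ∀ {k} → Geodetic k D → ∀ {u v v′ ℓ₁ ℓ₂} → v ≡ v′ → (p : Walk D u v ℓ₁) (q : Walk D u v′ ℓ₂) →
                   ℓ₁ ≤ k → ℓ₂ ≤ k → trail p ≡ trail q
  geodetic-trail geo {u} {v} refl p q ℓ₁≤k ℓ₂≤k = cong (λ (_ , r) → trail r) (geo u v _ _ p q ℓ₁≤k ℓ₂≤k)

module MooreBound {n} (D : Digraph n) {c} (outdeg≡c : ∀ u → outdeg D u ≡ c) where

  successor : Fin n → Fin c → Fin n
  successor u i = lookup (successors D u) (cast (sym (outdeg≡c u)) i)

  successor-arc : ∀ u i → arc D u (successor u i) ≡ true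
  successor-arc u i = ∈-successors⁻ D (∈-lookup _)

  successor-injective : ∀ u {i j} → successor u i ≡ successor u j → i ≡ j
  successor-injective u {i} {j} eq = begin
    i                                ≡⟨ cast-involutive (outdeg≡c u) _ i ⟨
    cast _ (cast (sym (outdeg≡c u)) i) ≡⟨ cong (cast _) (unique-lookup-injective (successors-unique D u) eq) ⟩
    cast _ (cast (sym (outdeg≡c u)) j) ≡⟨ cast-involutive (outdeg≡c u) _ j ⟩
    j                                ∎
    where open ≡-Reasoning

  endpoint : Fin n → List (Fin c) → Fin n
  endpoint u []       = u
  endpoint u (i ∷ is) = endpoint (successor u i) is

  walkAlong : ∀ u is → Walk D u (endpoint u is) (length is)
  walkAlong u []       = nil
  walkAlong u (i ∷ is) = cons (successor-arc u i) (walkAlong (successor u i) is)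

  trail-walkAlong-injective : ∀ u is js → trail D (walkAlong u is) ≡ trail D (walkAlong u js) → is ≡ js
  trail-walkAlong-injective u []       []       _  = refl
  trail-walkAlong-injective u (i ∷ is) (j ∷ js) eq with successor-injective u (∷-injectiveˡ eq)
  ... | refl = cong (i ∷_) (trail-walkAlong-injective (successor u i) is js (∷-injectiveʳ eq))

  moore-bound : ∀ {k} → Geodetic k D → Fin n → c ^ k ≤ n
  moore-bound {k} geo u = injective⇒≤ {f = λ i → endpoint u (toWord k i)} λ {i} {j} eq →
    toWord-injective k (trail-walkAlong-injective u (toWord k i) (toWord k j)
      (geodetic-trail D geo eq (walkAlong u (toWord k i)) (walkAlong u (toWord k j)) (len≤k i) (len≤k j)))
    where
    len≤k : ∀ i → length (toWord k i) ≤ k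
    len≤k i = ≤-reflexive (length-toWord k i)

shift : List A → A → List A
shift s a = drop 1 s ∷ʳ a

∈-shift : ∀ (s : List A) a → a ∈ shift s a
∈-shift s a = ∈-++⁺ʳ (drop 1 s) (here refl)

length-shift : ∀ {k} .{{_ : NonZero k}} (s : List A) a → length s ≡ k → length (shift s a) ≡ k
length-shift {k = k} s a len = begin
  length (drop 1 s ++ a ∷ [])  ≡⟨ length-++ (drop 1 s) ⟩
  length (drop 1 s) + 1        ≡⟨ cong (_+ 1) (trans (length-drop 1 s) (cong (_∸ 1) len)) ⟩
  k ∸ 1 + 1                    ≡⟨ m∸n+n≡m (>-nonZero⁻¹ k) ⟩
  k                            ∎
  where open ≡-Reasoning

drop-shift : ∀ ℓ (s : List A) a → ℓ < length s → drop ℓ (shift s a) ≡ drop (suc ℓ) s ∷ʳ a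
drop-shift zero    (_ ∷ _)     _ _        = refl
drop-shift (suc ℓ) (_ ∷ y ∷ s) a (s≤s lt) = drop-shift ℓ (y ∷ s) a lt

-- Along a walk of length ℓ ≤ k from u, the letter shifted in by the first arc ends up at position
-- k ∸ ℓ of the final word, and it does not occur in the word of u. Hence two walks from u to v of
-- lengths at most k have the same length and the same first arc, and so are equal by induction.

module ShiftLabelling {n k : ℕ} {A : Set} (D : Digraph n) (label : Fin n → List A)
  (length-label : ∀ v → length (label v) ≡ k)
  (arc⇒shift : ∀ {u v} → arc D u v ≡ true → ∃ λ a → a ∉ label u × label v ≡ shift (label u) a)
  (arc-label-injective : ∀ {u v w} → arc D u v ≡ true → arc D u w ≡ true → label v ≡ label w → v ≡ w)
  where

  letter : ∀ {u v} → arc D u v ≡ true → A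
  letter e = proj₁ (arc⇒shift e)

  letter-∉ : ∀ {u v} (e : arc D u v ≡ true) → letter e ∉ label u
  letter-∉ e = proj₁ (proj₂ (arc⇒shift e))

  label-shift : ∀ {u v} (e : arc D u v ≡ true) → label v ≡ shift (label u) (letter e)
  label-shift e = proj₂ (proj₂ (arc⇒shift e))

  label-along : ∀ {x v ℓ} s a → length s ≡ k → label x ≡ shift s a → Walk D x v ℓ → suc ℓ ≤ k →
                ∃ λ rest → label v ≡ drop (suc ℓ) s ++ a ∷ rest
  label-along s a _ lx nil _ = [] , lx
  label-along {x} {ℓ = suc ℓ} s a len lx (cons e p) ℓ+2≤k
    with rest , lv ← label-along (label x) (letter e) (length-label x) (label-shift e) p
                       (≤-trans (n≤1+n _) ℓ+2≤k)
    = letter e ∷ rest , (begin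
    label _                                             ≡⟨ lv ⟩
    drop (suc ℓ) (label x) ++ letter e ∷ rest          ≡⟨ cong (λ w → drop (suc ℓ) w ++ _) lx ⟩
    drop (suc ℓ) (shift s a) ++ letter e ∷ rest        ≡⟨ cong (_++ _) (drop-shift (suc ℓ) s a ℓ+1<len) ⟩
    (drop (suc (suc ℓ)) s ∷ʳ a) ++ letter e ∷ rest     ≡⟨ ++-assoc (drop (suc (suc ℓ)) s) _ _ ⟩
    drop (suc (suc ℓ)) s ++ a ∷ letter e ∷ rest        ∎)
    where
    open ≡-Reasoning
    ℓ+1<len : suc ℓ < length s
    ℓ+1<len = subst (suc ℓ <_) (sym len) ℓ+2≤k

  label-along-arc : ∀ {u x v ℓ} (e : arc D u x ≡ true) → Walk D x v ℓ → suc ℓ ≤ k →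
                    ∃ λ rest → label v ≡ drop (suc ℓ) (label u) ++ letter e ∷ rest
  label-along-arc {u} e = label-along (label u) (letter e) (length-label u) (label-shift e)

  label-along-walk : ∀ {u v ℓ} → Walk D u v ℓ → ℓ ≤ k → ∃ λ rest → label v ≡ drop ℓ (label u) ++ rest
  label-along-walk {u} nil        _   = [] , sym (++-identityʳ (label u))
  label-along-walk     (cons e p) ℓ≤k with rest , lv ← label-along-arc e p ℓ≤k = letter e ∷ rest , lv

  shorter-walk-absurd : ∀ {u v ℓ₁ ℓ₂} → Walk D u v ℓ₁ → Walk D u v ℓ₂ → ℓ₁ < ℓ₂ → ℓ₂ ≤ k → ⊥
  shorter-walk-absurd {u} {ℓ₁ = ℓ₁} {suc ℓ₂} p (cons e q) ℓ₁<ℓ₂ ℓ₂≤k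
    with _ , lv₁ ← label-along-walk p (≤-trans (<⇒≤ ℓ₁<ℓ₂) ℓ₂≤k)
       | _ , lv₂ ← label-along-arc e q ℓ₂≤k
    = letter-∉ e
        (Sublist.lookup (drop-⊆ ℓ₁ (label u))
          (∈-prefix (drop ℓ₁ (label u)) (drop (suc ℓ₂) (label u)) (trans (sym lv₁) lv₂) shorter))
    where
    shorter : length (drop (suc ℓ₂) (label u)) < length (drop ℓ₁ (label u))
    shorter = subst₂ _<_ (sym (trans (length-drop (suc ℓ₂) (label u)) (cong (_∸ suc ℓ₂) (length-label u))))
                         (sym (trans (length-drop ℓ₁ (label u)) (cong (_∸ ℓ₁) (length-label u))))
                         (∸-monoʳ-< ℓ₁<ℓ₂ ℓ₂≤k)

  letter-injective : ∀ {u x y} (e : arc D u x ≡ true) (e′ : arc D u y ≡ true) → letter e ≡ letter e′ → x ≡ y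
  letter-injective {u} e e′ same = arc-label-injective e e′ (begin
    label _                      ≡⟨ label-shift e ⟩
    shift (label u) (letter e)   ≡⟨ cong (shift (label u)) same ⟩
    shift (label u) (letter e′)  ≡⟨ label-shift e′ ⟨
    label _                      ∎)
    where open ≡-Reasoning

  equal-length-walks-≡ : ∀ {u v ℓ} (p q : Walk D u v ℓ) → ℓ ≤ k → p ≡ q
  equal-length-walks-≡ nil nil _ = refl
  equal-length-walks-≡ {u} {ℓ = suc ℓ} (cons e p) (cons e′ q) ℓ≤k
    with _ , lv₁ ← label-along-arc e p ℓ≤k
       | _ , lv₂ ← label-along-arc e′ q ℓ≤k
    with refl ← letter-injective e e′
                  (∷-injectiveˡ (++-cancelˡ (drop (suc ℓ) (label u)) _ _ (trans (sym lv₁) lv₂)))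
    = cong₂ cons (uip e e′) (equal-length-walks-≡ p q (≤-trans (n≤1+n ℓ) ℓ≤k))

  geodetic : Geodetic k D
  geodetic u v ℓ₁ ℓ₂ p q ℓ₁≤k ℓ₂≤k with <-cmp ℓ₁ ℓ₂
  ... | tri< ℓ₁<ℓ₂ _ _ = ⊥-elim (shorter-walk-absurd p q ℓ₁<ℓ₂ ℓ₂≤k)
  ... | tri≈ _ refl _  = cong (ℓ₁ ,_) (equal-length-walks-≡ p q ℓ₁≤k)
  ... | tri> _ _ ℓ₂<ℓ₁ = ⊥-elim (shorter-walk-absurd q p ℓ₂<ℓ₁ ℓ₁≤k)

-- The r padding vertices (the inj₂ part) carry the constant word z…z, so they copy its out-arcs;
-- they have no in-arcs.

module Construction {B : ℕ} (z : Fin B) (k r : ℕ) .{{_ : NonZero k}} where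
  open DecMembership (Fin._≟_ {B}) using (_∉?_)
  open DecMembership (≡-dec (Fin._≟_ {B})) using () renaming (_∈?_ to _∈ʷ?_)

  labelOf : Fin (B ^ k) ⊎ Fin r → List (Fin B)
  labelOf (inj₁ i) = toWord k i
  labelOf (inj₂ _) = replicate k z

  label : Fin (B ^ k + r) → List (Fin B)
  label v = labelOf (splitAt (B ^ k) v)

  length-label : ∀ v → length (label v) ≡ k
  length-label v with splitAt (B ^ k) v
  ... | inj₁ i = length-toWord k i
  ... | inj₂ _ = length-replicate k

  fresh : List (Fin B) → List (Fin B)
  fresh s = take (B ∸ k) (filter (_∉? s) (allFin B))

  fresh-∉ : ∀ {a} s → a ∈ fresh s → a ∉ s
  fresh-∉ s a∈ = proj₂ (∈-filter⁻ (_∉? s) {xs = allFin B} (Sublist.lookup (take-⊆ (B ∸ k) _) a∈))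

  length-fresh : ∀ s → length s ≡ k → length (fresh s) ≡ B ∸ k
  length-fresh s len = trans (length-take (B ∸ k) _)
    (m≤n⇒m⊓n≡m (subst (λ l → B ∸ l ≤ _) len (length-filter-∉ s)))

  arcFrom : List (Fin B) → Fin (B ^ k) ⊎ Fin r → Bool
  arcFrom s (inj₁ i) = does (toWord k i ∈ʷ? map (shift s) (fresh s))
  arcFrom s (inj₂ _) = false

  loopless′ : ∀ u → arcFrom (label u) (splitAt (B ^ k) u) ≡ false
  loopless′ u with splitAt (B ^ k) u
  ... | inj₂ _ = refl
  ... | inj₁ i = dec-false (toWord k i ∈ʷ? map (shift s) (fresh s)) λ w∈ →
    let a , a∈ , w≡ = ∈-map⁻ (shift s) w∈ in fresh-∉ s a∈ (subst (a ∈_) (sym w≡) (∈-shift s a))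
    where s = toWord k i

  D : Digraph (B ^ k + r)
  D = record { arc = λ u v → arcFrom (label u) (splitAt (B ^ k) v) ; loopless = loopless′ }

  ArcTo : Fin (B ^ k + r) → Fin (B ^ k + r) → Set
  ArcTo u v = ∃₂ λ i a → splitAt (B ^ k) v ≡ inj₁ i × a ∈ fresh (label u) × toWord k i ≡ shift (label u) a

  arc⇒ArcTo : ∀ {u v} → arc D u v ≡ true → ArcTo u v
  arc⇒ArcTo {u} {v} e with splitAt (B ^ k) v
  ... | inj₁ i with toWord k i ∈ʷ? map (shift (label u)) (fresh (label u))
  ...   | yes w∈ = let a , a∈ , w≡ = ∈-map⁻ (shift (label u)) w∈ in i , a , refl , a∈ , w≡

  next : List (Fin B) → Fin B → Fin (B ^ k + r)
  next s a = fromWord k z (shift s a) ↑ˡ r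

  next-injective : ∀ s → length s ≡ k → ∀ {a b} → next s a ≡ next s b → a ≡ b
  next-injective s len {a} {b} eq = ∷-injectiveˡ (++-cancelˡ (drop 1 s) _ _ (begin
    shift s a                                ≡⟨ toWord-fromWord k z _ (length-shift s a len) ⟨
    toWord k (fromWord k z (shift s a))      ≡⟨ cong (toWord k) (↑ˡ-injective r _ _ eq) ⟩
    toWord k (fromWord k z (shift s b))      ≡⟨ toWord-fromWord k z _ (length-shift s b len) ⟩
    shift s b                                ∎))
    where open ≡-Reasoning

  ArcTo⇒≡next : ∀ {u v} → ((i , a , split≡ , _ , w≡) : ArcTo u v) → v ≡ next (label u) a
  ArcTo⇒≡next (i , a , split≡ , _ , w≡) =
    trans (sym (splitAt⁻¹-↑ˡ split≡)) (cong (_↑ˡ r) (trans (sym (fromWord-toWord k z i)) (cong (fromWord k z) w≡)))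

  arc-next : ∀ u {a} → a ∈ fresh (label u) → arc D u (next (label u) a) ≡ true
  arc-next u {a} a∈ rewrite splitAt-↑ˡ (B ^ k) (fromWord k z (shift (label u) a)) r =
    dec-true (_ ∈ʷ? _) (subst (_∈ map (shift (label u)) (fresh (label u)))
                              (sym (toWord-fromWord k z _ (length-shift (label u) a (length-label u))))
                              (∈-map⁺ (shift (label u)) a∈))

  outdeg-D : ∀ u → outdeg D u ≡ B ∸ k
  outdeg-D u = begin
    length (successors D u)                   ≡⟨ ≤-antisym (unique⊆⇒length≤ (successors-unique D u) ⊆nexts)
                                                           (unique⊆⇒length≤ nexts-unique nexts⊆) ⟩
    length (map (next s) (fresh s))           ≡⟨ length-map (next s) (fresh s) ⟩
    length (fresh s)                          ≡⟨ length-fresh s (length-label u) ⟩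
    B ∸ k                                     ∎
    where
    open ≡-Reasoning
    s = label u
    nexts-unique : Unique (map (next s) (fresh s))
    nexts-unique = Unique.map⁺ (next-injective s (length-label u))
                     (Unique.take⁺ (B ∸ k) (Unique.filter⁺ (_∉? s) (Unique.allFin⁺ B)))
    ⊆nexts : ∀ {v} → v ∈ successors D u → v ∈ map (next s) (fresh s)
    ⊆nexts v∈ with arc⇒ArcTo (∈-successors⁻ D v∈)
    ... | arcTo@(_ , _ , _ , a∈ , _) = subst (_∈ _) (sym (ArcTo⇒≡next arcTo)) (∈-map⁺ (next s) a∈)
    nexts⊆ : ∀ {v} → v ∈ map (next s) (fresh s) → v ∈ successors D u
    nexts⊆ v∈ with ∈-map⁻ (next s) v∈
    ... | a , a∈ , refl = ∈-successors⁺ D (arc-next u a∈)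

  geodetic-D : Geodetic k D
  geodetic-D = ShiftLabelling.geodetic D label length-label arc⇒shift arc-label-injective
    where
    arc⇒shift : ∀ {u v} → arc D u v ≡ true → ∃ λ a → a ∉ label u × label v ≡ shift (label u) a
    arc⇒shift e with arc⇒ArcTo e
    ... | i , a , split≡ , a∈ , w≡ = a , fresh-∉ _ a∈ , trans (cong labelOf split≡) w≡
    arc-label-injective : ∀ {u v w} → arc D u v ≡ true → arc D u w ≡ true → label v ≡ label w → v ≡ w
    arc-label-injective e e′ lv≡lw with arc⇒ArcTo e | arc⇒ArcTo e′
    ... | i , _ , split≡ , _ | j , _ , split≡′ , _ =
      trans (sym (splitAt⁻¹-↑ˡ split≡))
        (trans (cong (_↑ˡ r) (toWord-injective k (trans (cong labelOf (sym split≡)) (trans lv≡lw (cong labelOf split≡′)))))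
               (splitAt⁻¹-↑ˡ split≡′))

geodetic-digraph : ∀ k .{{_ : NonZero k}} B {n} → 0 < B → B ^ k ≤ n →
                   Σ (Digraph n) λ D → (∀ u → outdeg D u ≡ B ∸ k) × Geodetic k D
geodetic-digraph k (suc b) _ Bᵏ≤n = padded (m+[n∸m]≡n Bᵏ≤n)
  where
  padded : ∀ {r n} → suc b ^ k + r ≡ n → Σ (Digraph n) λ D → (∀ u → outdeg D u ≡ suc b ∸ k) × Geodetic k D
  padded {r} refl = D , outdeg-D , geodetic-D
    where open Construction zero k r

^-distribʳ-* : ∀ m n k → (m * n) ^ k ≡ m ^ k * n ^ k
^-distribʳ-* m n zero    = refl
^-distribʳ-* m n (suc k) = trans (cong (m * n *_) (^-distribʳ-* m n k)) (interchange m n (m ^ k) (n ^ k))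
  where
  interchange : ∀ a b x y → (a * b) * (x * y) ≡ (a * x) * (b * y)
  interchange = solve-∀

∃-root : ∀ k n → ∃ λ B → B ^ suc k ≤ n × n < suc B ^ suc k
∃-root k zero = 0 , z≤n , m^n>0 1 (suc k)
∃-root k (suc n) with B , Bᵏ≤n , n<[1+B]ᵏ ← ∃-root k n with suc n <? suc B ^ suc k
... | yes 1+n<[1+B]ᵏ = B , m≤n⇒m≤1+n Bᵏ≤n , 1+n<[1+B]ᵏ
... | no  1+n≮[1+B]ᵏ = suc B , ≤-reflexive (sym 1+n≡[1+B]ᵏ) ,
                       subst (_< suc (suc B) ^ suc k) (sym 1+n≡[1+B]ᵏ) (^-monoˡ-< (suc k) (n<1+n (suc B)))
  where
  1+n≡[1+B]ᵏ : suc n ≡ suc B ^ suc k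
  1+n≡[1+B]ᵏ = ≤-antisym n<[1+B]ᵏ (≮⇒≥ 1+n≮[1+B]ᵏ)

root-lower : ∀ k c {n B} → c ^ suc k ≤ n → n < suc B ^ suc k → c ≤ B
root-lower k c cᵏ≤n n<[1+B]ᵏ = ≮⇒≥ λ B<c → <⇒≱ n<[1+B]ᵏ (≤-trans (^-monoˡ-≤ (suc k) B<c) cᵏ≤n)

-- The out-degree B ∸ k of the construction is within a factor m / (m + 1) of the root bound B + 1.
fresh-letters-ratio : ∀ m k {B} → suc m * suc k ≤ B → m * suc B ≤ suc m * (B ∸ k)
fresh-letters-ratio m k {B} large = subst (λ x → m * suc x ≤ suc m * d) (m∸n+n≡m k≤B) (begin
  m * suc (d + k)      ≡⟨ expand m k d ⟩
  m * d + m * suc k    ≤⟨ +-monoʳ-≤ (m * d) m[1+k]≤d ⟩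
  m * d + d            ≡⟨ +-comm (m * d) d ⟩
  suc m * d            ∎)
  where
  open ≤-Reasoning
  d = B ∸ k
  k≤B : k ≤ B
  k≤B = ≤-trans (≤-trans (m≤m+n k (m * suc k)) (n≤1+n _)) large
  expand : ∀ m k d → m * suc (d + k) ≡ m * d + m * suc k
  expand = solve-∀
  regroup : ∀ m k → suc m * suc k ≡ suc (m * suc k) + k
  regroup = solve-∀
  m[1+k]≤d : m * suc k ≤ d
  m[1+k]≤d = <⇒≤ (+-cancelʳ-≤ k _ d (subst₂ _≤_ (regroup m k) (sym (m∸n+n≡m k≤B)) large))

lower-bound-arith : ∀ k m {n B e} → suc m * suc k ≤ B → n < suc B ^ k → n * (B ∸ k) ≤ e →
                    m ^ k * n ^ suc k ≤ suc m ^ k * e ^ k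
lower-bound-arith k m {n} {B} {e} large n<[1+B]ᵏ n[B-k]≤e = begin
  m ^ k * (n * n ^ k)                ≤⟨ *-monoʳ-≤ (m ^ k) (*-monoˡ-≤ (n ^ k) (<⇒≤ n<[1+B]ᵏ)) ⟩
  m ^ k * (suc B ^ k * n ^ k)        ≡⟨ *-assoc (m ^ k) _ _ ⟨
  m ^ k * suc B ^ k * n ^ k          ≡⟨ cong (_* n ^ k) (^-distribʳ-* m (suc B) k) ⟨
  (m * suc B) ^ k * n ^ k            ≤⟨ *-monoˡ-≤ (n ^ k) (^-monoˡ-≤ k (fresh-letters-ratio m k large)) ⟩
  (suc m * (B ∸ k)) ^ k * n ^ k      ≡⟨ cong (_* n ^ k) (^-distribʳ-* (suc m) (B ∸ k) k) ⟩
  suc m ^ k * (B ∸ k) ^ k * n ^ k    ≡⟨ *-assoc (suc m ^ k) _ _ ⟩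
  suc m ^ k * ((B ∸ k) ^ k * n ^ k)  ≡⟨ cong (suc m ^ k *_) (trans (^-distribʳ-* n (B ∸ k) k) (*-comm (n ^ k) _)) ⟨
  suc m ^ k * (n * (B ∸ k)) ^ k      ≤⟨ *-monoʳ-≤ (suc m ^ k) (^-monoˡ-≤ k n[B-k]≤e) ⟩
  suc m ^ k * e ^ k                  ∎
  where open ≤-Reasoning

size-upper : ∀ {n k} (D : Digraph n) → OutRegular D → Geodetic k D → 0 < n → size D ^ k ≤ n ^ suc k
size-upper {n} {k} D (c , outdeg≡c) geo 0<n = begin
  size D ^ k       ≡⟨ cong (_^ k) (size-outRegular D outdeg≡c) ⟩
  (n * c) ^ k      ≡⟨ ^-distribʳ-* n c k ⟩
  n ^ k * c ^ k    ≤⟨ *-monoʳ-≤ (n ^ k) (MooreBound.moore-bound D outdeg≡c geo (Fin.fromℕ< 0<n)) ⟩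
  n ^ k * n        ≡⟨ *-comm (n ^ k) n ⟩
  n ^ suc k        ∎
  where open ≤-Reasoning

size-lower : ∀ {n e} k .{{_ : NonZero k}} → (∀ (D : Digraph n) → OutRegular D → Geodetic k D → size D ≤ e) →
             ∀ B → 0 < B → B ^ k ≤ n → n * (B ∸ k) ≤ e
size-lower k maximal B 0<B Bᵏ≤n with D , outdeg≡ , geo ← geodetic-digraph k B 0<B Bᵏ≤n =
  subst (_≤ _) (size-outRegular D outdeg≡) (maximal D (_ , outdeg≡) geo)

theorem4 : ∀ (k : ℕ) → 2 ≤ k → ∀ (m : ℕ) → 1 ≤ m →
    ∃ λ (N : ℕ) → ∀ (n e : ℕ) → N ≤ n → IsExOut n k e →
    ((m ∸ 1) ^ k * n ^ suc k ≤ m ^ k * e ^ k) ×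
    (m ^ k * e ^ k ≤ suc m ^ k * n ^ suc k)
theorem4 (suc k) _ (suc m) _ = (suc m * suc (suc k)) ^ suc k , bounds
  where
  bounds : ∀ n e → (suc m * suc (suc k)) ^ suc k ≤ n → IsExOut n (suc k) e →
           (m ^ suc k * n ^ suc (suc k) ≤ suc m ^ suc k * e ^ suc k) ×
           (suc m ^ suc k * e ^ suc k ≤ suc (suc m) ^ suc k * n ^ suc (suc k))
  bounds n e N≤n ((D , regular , geodetic , refl) , maximal)
    with B , Bᵏ≤n , n<[1+B]ᵏ ← ∃-root k n
    = lower-bound-arith (suc k) m large n<[1+B]ᵏ (size-lower (suc k) maximal B (≤-trans (s≤s z≤n) large) Bᵏ≤n)
    , *-mono-≤ (^-monoˡ-≤ (suc k) (n≤1+n (suc m)))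
               (size-upper D regular geodetic (≤-trans (m^n>0 (suc m * suc (suc k)) (suc k)) N≤n))
    where
    large : suc m * suc (suc k) ≤ B
    large = root-lower k (suc m * suc (suc k)) N≤n n<[1+B]ᵏ
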